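{- Let $w\ge 1$, $s\ge w+4$, and let $L_1,\dots,L_w$ be pairwise orthogonal Latin squares of order $s$ with rows and columns indexed by $\{0,\dots,s-1\}$; let the cells $(i,j)$ be the treatments. Call two distinct cells first associates if they lie in different rows, in different columns, and carry different symbols in each $L_k$ ($k=1,\dots,w$). (1) Let $t$ be a cell and let $A_i,A_j$ be disjoint sets of cells such that $\{t\}\cup A_i$ and $\{t\}\cup A_j$ are common transversals of $L_1,\dots,L_w$. Then for every $a\in A_i$, exactly $(s-1-w)-2$ cells of $A_j$ are first associates of $a$. (2) Equivalently, in the net $N$ whose points are the cells and whose lines are the rows, the columns, and for each $k$ the $s$ sets of cells carrying a fixed symbol of $L_k$: if $\alpha_i,\alpha_j$ are transversals of $N$ with $\alpha_i\cap\alpha_j=\{P\}$, then every point of $\alpha_i$ other than $P$ is not joined in $N$ to exactly $(s-1-w)-2$ points of $\alpha_j$ other than $P$.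
   Context: Two Latin squares of order $s$ are orthogonal if superimposing them yields all $s^2$ ordered pairs of symbols. A common transversal of $L_1,\dots,L_w$ is a set of $s$ cells containing exactly one cell in each row and each column, whose $s$ cells carry $s$ distinct symbols in each $L_k$ (equivalently, a set of $s$ cells pairwise first associates). In a net, two distinct points are joined if some line contains both; a transversal of the net is a set of $s$ points no two of which are joined. -}

module Defs where

open import Data.Nat using (ℕ; zero; suc)
open import Data.Fin using (Fin)
open import Data.Product using (Σ; _×_; _,_; proj₁; proj₂)
open import Data.List using (List; []; _∷_; length)
open import Data.List.Membership.Propositional using (_∈_; _∉_)
open import Data.List.Relation.Unary.Unique.Propositional using (Unique)
open import Data.List.Relation.Unary.AllPairs using (AllPairs)
open import Relation.Binary.PropositionalEquality using (_≡_; _≢_)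
open import Relation.Nullary using (¬_)

Cell : ℕ → Set
Cell s = Fin s × Fin s

row : ∀ {s} → Cell s → Fin s
row = proj₁

col : ∀ {s} → Cell s → Fin s
col = proj₂

Square : ℕ → Set
Square s = Cell s → Fin s

IsLatin : ∀ {s} → Square s → Set
IsLatin {s} L =
  (∀ (i a : Fin s) → Σ (Fin s) (λ j → L (i , j) ≡ a × (∀ j' → L (i , j') ≡ a → j' ≡ j)))
  × (∀ (j a : Fin s) → Σ (Fin s) (λ i → L (i , j) ≡ a × (∀ i' → L (i' , j) ≡ a → i' ≡ i)))

Orthogonal : ∀ {s} → Square s → Square s → Set
Orthogonal {s} L M = ∀ (a b : Fin s) → Σ (Cell s) (λ c → L c ≡ a × M c ≡ b)

MOLS : ∀ {w s} → (Fin w → Square s) → Set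
MOLS {w} L = (∀ k → IsLatin (L k)) × (∀ (k l : Fin w) → k ≢ l → Orthogonal (L k) (L l))

FirstAssoc : ∀ {w s} → (Fin w → Square s) → Cell s → Cell s → Set
FirstAssoc L c d = c ≢ d × row c ≢ row d × col c ≢ col d × (∀ k → L k c ≢ L k d)

data CountIs {A : Set} (P : A → Set) : List A → ℕ → Set where
  nil  : CountIs P [] 0
  yes  : ∀ {x xs n} → P x → CountIs P xs n → CountIs P (x ∷ xs) (suc n)
  no   : ∀ {x xs n} → ¬ P x → CountIs P xs n → CountIs P (x ∷ xs) n

-- Finite sets of cells are represented by duplicate-free lists.
CommonTransversal : ∀ {w s} → (Fin w → Square s) → List (Cell s) → Set
CommonTransversal {w} {s} L T =
  Unique T × length T ≡ s
  × (∀ (r : Fin s) → CountIs (λ c → row c ≡ r) T 1)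
  × (∀ (j : Fin s) → CountIs (λ c → col c ≡ j) T 1)
  × (∀ (k : Fin w) → AllPairs (λ c d → L k c ≢ L k d) T)

data Line (w s : ℕ) : Set where
  rowLine : Fin s → Line w s
  colLine : Fin s → Line w s
  symLine : Fin w → Fin s → Line w s

OnLine : ∀ {w s} → (Fin w → Square s) → Line w s → Cell s → Set
OnLine L (rowLine r) c = row c ≡ r
OnLine L (colLine j) c = col c ≡ j
OnLine L (symLine k a) c = L k c ≡ a

Joined : ∀ {w s} → (Fin w → Square s) → Cell s → Cell s → Set
Joined {w} {s} L P Q = P ≢ Q × Σ (Line w s) (λ ℓ → OnLine L ℓ P × OnLine L ℓ Q)

NetTransversal : ∀ {w s} → (Fin w → Square s) → List (Cell s) → Set
NetTransversal {w} {s} L T =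
  Unique T × length T ≡ s × AllPairs (λ P Q → ¬ Joined L P Q) T

module Submission where

-- View the cells as the points of the net N whose lines are the
-- rows, the columns and the symbol classes of each L k.  Because the squares
-- are Latin and pairwise orthogonal, two distinct lines meet in at most one
-- point, so the w + 2 lines through a point a (its pencil) are disjoint
-- away from a.  Both kinds of transversal in the theorem meet every line of
-- N exactly once (for the symbol lines this is a pigeonhole argument: s
-- cells with distinct symbols in Fin s take every symbol).  Hence a set X of
-- s such points not containing a has exactly w + 2 points collinear with a,
-- one on each line of the pencil, and s - (w + 2) points not collinear
-- with a.  Part (1) applies this to X = t ∷ Aj and part (2) to X = αj; in
-- both cases exactly one of the counted points (t, resp. P) must be
-- discarded, which gives s - (w + 2) - 1 = (s - 1 - w) - 2.

open import Defs
open import Data.Nat using (ℕ; zero; suc; _+_; _∸_; _≤_; z≤n; s≤s)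
open import Data.Nat.Properties using (+-suc; +-∸-assoc; +-comm; +-monoʳ-≤; n≤1+n; ≤-refl; ≤-trans; ≤-reflexive; 1+n≰n; m≤n⇒m≤1+n)
open import Data.Fin using (Fin; zero; suc; punchOut)
open import Data.Fin.Properties using (_≟_; any?; punchOut-injective; injective⇒≤; suc-injective; 0≢1+n; ⊎⇔∃)
open import Data.Product using (Σ; _×_; _,_; proj₁; proj₂; map₂)
open import Data.Sum using (_⊎_; inj₁; inj₂; [_,_])
open import Data.List using (List; []; _∷_; length; lookup)
open import Data.List.Membership.Propositional using (_∈_; _∉_)
open import Data.List.Membership.Propositional.Properties using (∈-lookup)
open import Data.List.Relation.Unary.Any using (here; there)
import Data.List.Relation.Unary.All as All
open import Data.List.Relation.Unary.AllPairs using (AllPairs; _∷_)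
import Data.List.Relation.Unary.AllPairs as AllPairs
open import Data.List.Relation.Unary.Unique.Propositional using (Unique)
open import Data.List.Relation.Unary.Unique.Propositional.Properties using (Unique[x∷xs]⇒x∉xs)
open import Data.Empty using (⊥; ⊥-elim)
open import Function using (_∘_)
open import Function.Bundles using (_⇔_; mk⇔; Equivalence)
open import Function.Definitions using (Injective; StrictlySurjective)
open import Relation.Binary.PropositionalEquality using (_≡_; _≢_; refl; sym; trans; cong; cong₂; subst; module ≡-Reasoning)
open import Relation.Nullary using (¬_) renaming (yes to yes′; no to no′)

-- Counting with CountIs

module _ {A : Set} where

  count-none : ∀ {P : A → Set} {xs} → (∀ {x} → x ∈ xs → ¬ P x) → CountIs P xs 0
  count-none {xs = []} _ = nil
  count-none {xs = x ∷ xs} none = no (none (here refl)) (count-none (none ∘ there))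

  count-zero⇒none : ∀ {P : A → Set} {xs x} → CountIs P xs 0 → x ∈ xs → ¬ P x
  count-zero⇒none (no ¬px _) (here refl) = ¬px
  count-zero⇒none (no _ c) (there x∈) = count-zero⇒none c x∈

  count-cong : ∀ {P Q : A → Set} {xs n} → (∀ {x} → x ∈ xs → P x ⇔ Q x) →
    CountIs P xs n → CountIs Q xs n
  count-cong P⇔Q nil = nil
  count-cong P⇔Q (yes p c) = yes (Equivalence.to (P⇔Q (here refl)) p) (count-cong (P⇔Q ∘ there) c)
  count-cong P⇔Q (no ¬p c) = no (¬p ∘ Equivalence.from (P⇔Q (here refl))) (count-cong (P⇔Q ∘ there) c)

  count≤length : ∀ {P : A → Set} {xs n} → CountIs P xs n → n ≤ length xs
  count≤length nil = z≤n
  count≤length (yes _ c) = s≤s (count≤length c)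
  count≤length (no _ c) = m≤n⇒m≤1+n (count≤length c)

  count-complement : ∀ {P : A → Set} {xs n} → CountIs P xs n → CountIs (λ x → ¬ P x) xs (length xs ∸ n)
  count-complement nil = nil
  count-complement (yes p c) = no (λ ¬p → ¬p p) (count-complement c)
  count-complement {xs = x ∷ xs} (no ¬p c) =
    subst (CountIs _ (x ∷ xs)) (sym (+-∸-assoc 1 (count≤length c))) (yes ¬p (count-complement c))

  count-⊎ : ∀ {P Q : A → Set} {xs m n} → (∀ {x} → x ∈ xs → P x → Q x → ⊥) →
    CountIs P xs m → CountIs Q xs n → CountIs (λ x → P x ⊎ Q x) xs (m + n)
  count-⊎ disjoint nil nil = nil
  count-⊎ disjoint (yes p _) (yes q _) = ⊥-elim (disjoint (here refl) p q)
  count-⊎ disjoint (yes p c) (no _ d) = yes (inj₁ p) (count-⊎ (disjoint ∘ there) c d)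
  count-⊎ {m = m} {n = suc n} disjoint (no _ c) (yes q d) =
    subst (CountIs _ _) (sym (+-suc m n)) (yes (inj₂ q) (count-⊎ (disjoint ∘ there) c d))
  count-⊎ disjoint (no ¬p c) (no ¬q d) = no [ ¬p , ¬q ] (count-⊎ (disjoint ∘ there) c d)

  count-Σ : ∀ {xs} n (P : Fin n → A → Set) → (∀ {x} → x ∈ xs → ∀ {i j} → P i x → P j x → i ≡ j) →
    (∀ i → CountIs (P i) xs 1) → CountIs (λ x → Σ (Fin n) (λ i → P i x)) xs n
  count-Σ zero P _ _ = count-none (λ _ → λ { (() , _) })
  count-Σ (suc n) P disjoint once =
    count-cong (λ _ → ⊎⇔∃)
      (count-⊎ (λ x∈ p (_ , q) → 0≢1+n (disjoint x∈ p q)) (once zero)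
        (count-Σ n (P ∘ suc) (λ x∈ p q → suc-injective (disjoint x∈ p q)) (once ∘ suc)))

  count-one⇒unique : ∀ {P : A → Set} {xs x y} → CountIs P xs 1 → x ∈ xs → y ∈ xs → P x → P y → x ≡ y
  count-one⇒unique (yes _ _) (here refl) (here refl) _ _ = refl
  count-one⇒unique (yes _ c) (here refl) (there y∈) _ py = ⊥-elim (count-zero⇒none c y∈ py)
  count-one⇒unique (yes _ c) (there x∈) _ px _ = ⊥-elim (count-zero⇒none c x∈ px)
  count-one⇒unique (no ¬p _) (here refl) _ px _ = ⊥-elim (¬p px)
  count-one⇒unique (no ¬p _) (there _) (here refl) _ py = ⊥-elim (¬p py)
  count-one⇒unique (no _ c) (there x∈) (there y∈) px py = count-one⇒unique c x∈ y∈ px py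

  count-tail : ∀ {P : A → Set} {x xs n} → CountIs P (x ∷ xs) (suc n) → P x → CountIs P xs n
  count-tail (yes _ c) _ = c
  count-tail (no ¬p _) p = ⊥-elim (¬p p)

  count-without : ∀ {P : A → Set} {xs y n} → Unique xs → y ∈ xs → P y →
    CountIs P xs (suc n) → CountIs (λ x → x ≢ y × P x) xs n
  count-without (y∉ys ∷ _) (here refl) py c =
    no (λ (y≢y , _) → y≢y refl)
       (count-cong (λ x∈ → mk⇔ (λ px → (λ x≡y → All.lookup y∉ys x∈ (sym x≡y)) , px) proj₂) (count-tail c py))
  count-without {n = zero} _ (there y∈) py (yes _ c) = ⊥-elim (count-zero⇒none c y∈ py)
  count-without {n = suc n} (z∉ys ∷ u) (there y∈) py (yes pz c) =
    yes (All.lookup z∉ys y∈ , pz) (count-without u y∈ py c)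
  count-without (_ ∷ u) (there y∈) py (no ¬pz c) = no (¬pz ∘ proj₂) (count-without u y∈ py c)

-- Pigeonhole facts for maps into Fin n

-- An injection Fin m → Fin n with n ≤ m is onto: a missed value would let
-- us squeeze Fin m injectively into Fin (n - 1).
injective⇒onto : ∀ {m n} (h : Fin m → Fin n) → Injective _≡_ _≡_ h → n ≤ m → StrictlySurjective _≡_ h
injective⇒onto {m} {suc n} h h-inj n≤m v with any? (λ i → h i ≟ v)
... | yes′ hit = hit
... | no′ miss = ⊥-elim (1+n≰n (≤-trans n≤m (injective⇒≤ {f = squeezed} squeezed-inj)))
  where
  avoids : ∀ i → v ≢ h i
  avoids i v≡hi = miss (i , sym v≡hi)
  squeezed : Fin m → Fin n
  squeezed i = punchOut (avoids i)
  squeezed-inj : Injective _≡_ _≡_ squeezed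
  squeezed-inj e = h-inj (punchOut-injective (avoids _) (avoids _) e)

-- A surjection Fin n → Fin n is injective: its section is injective, hence
-- onto, hence a two-sided inverse.
onto⇒injective : ∀ {n} (h : Fin n → Fin n) → StrictlySurjective _≡_ h → Injective _≡_ _≡_ h
onto⇒injective {n} h onto {i} {j} hi≡hj = trans (sym (retract i)) (trans (cong section hi≡hj) (retract j))
  where
  section : Fin n → Fin n
  section v = proj₁ (onto v)
  section-inj : Injective _≡_ _≡_ section
  section-inj {u} {v} e = trans (sym (proj₂ (onto u))) (trans (cong h e) (proj₂ (onto v)))
  retract : ∀ i → section (h i) ≡ i
  retract i with injective⇒onto section section-inj ≤-refl i
  ... | u , section-u≡i = begin
    section (h i)           ≡⟨ cong (section ∘ h) (sym section-u≡i) ⟩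
    section (h (section u)) ≡⟨ cong section (proj₂ (onto u)) ⟩
    section u               ≡⟨ section-u≡i ⟩
    i                       ∎
    where open ≡-Reasoning

module _ {A : Set} {n : ℕ} (g : A → Fin n) where

  lookup-injective : ∀ {xs} → AllPairs (λ x y → g x ≢ g y) xs → Injective _≡_ _≡_ (g ∘ lookup xs)
  lookup-injective (_ ∷ _) {zero} {zero} _ = refl
  lookup-injective (gx∉ ∷ _) {zero} {suc j} e = ⊥-elim (All.lookup gx∉ (∈-lookup j) e)
  lookup-injective (gx∉ ∷ _) {suc i} {zero} e = ⊥-elim (All.lookup gx∉ (∈-lookup i) (sym e))
  lookup-injective (_ ∷ distinct) {suc i} {suc j} e = cong suc (lookup-injective distinct e)

  count-single : ∀ {xs x v} → AllPairs (λ x y → g x ≢ g y) xs → x ∈ xs → g x ≡ v →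
    CountIs (λ y → g y ≡ v) xs 1
  count-single (gx∉ ∷ _) (here refl) gx≡v =
    yes gx≡v (count-none (λ y∈ gy≡v → All.lookup gx∉ y∈ (trans gx≡v (sym gy≡v))))
  count-single (gz∉ ∷ distinct) (there x∈) gx≡v =
    no (λ gz≡v → All.lookup gz∉ x∈ (trans gz≡v (sym gx≡v))) (count-single distinct x∈ gx≡v)

  coordinate-hits-once : ∀ {xs} → AllPairs (λ x y → g x ≢ g y) xs → length xs ≡ n →
    ∀ v → CountIs (λ x → g x ≡ v) xs 1
  coordinate-hits-once {xs} distinct len v with
    injective⇒onto (g ∘ lookup xs) (lookup-injective distinct) (≤-reflexive (sym len)) v
  ... | i , e = count-single distinct (∈-lookup i) e

-- Latin squares

module _ {s : ℕ} {M : Square s} (latin : IsLatin M) where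

  latin-row : ∀ {c d} → row c ≡ row d → M c ≡ M d → c ≡ d
  latin-row {i , j} {.i , j'} refl e =
    let unique = proj₂ (proj₂ (proj₁ latin i (M (i , j')))) in
    cong (i ,_) (trans (unique j e) (sym (unique j' refl)))

  latin-col : ∀ {c d} → col c ≡ col d → M c ≡ M d → c ≡ d
  latin-col {i , j} {i' , .j} refl e =
    let unique = proj₂ (proj₂ (proj₂ latin j (M (i' , j)))) in
    cong (_, j) (trans (unique i e) (sym (unique i' refl)))

  -- Along the s cells carrying a fixed symbol a of M (one per row), N takes
  -- every value by orthogonality, hence takes each value only once.
  orthogonal-injective : ∀ {N : Square s} → Orthogonal M N → ∀ {c d} → M c ≡ M d → N c ≡ N d → c ≡ d
  orthogonal-injective {N} orth {i , j} {i' , j'} eM eN = cong₂ _,_ same-row (begin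
    j          ≡⟨ j≡column ⟩
    column i   ≡⟨ cong column same-row ⟩
    column i'  ≡⟨ sym j'≡column ⟩
    j'         ∎)
    where
    open ≡-Reasoning
    a : Fin s
    a = M (i , j)
    column : Fin s → Fin s
    column r = proj₁ (proj₁ latin r a)
    on-column : ∀ {r k} → M (r , k) ≡ a → k ≡ column r
    on-column {r} {k} = proj₂ (proj₂ (proj₁ latin r a)) k
    j≡column : j ≡ column i
    j≡column = on-column refl
    j'≡column : j' ≡ column i'
    j'≡column = on-column (sym eM)
    φ : Fin s → Fin s
    φ r = N (r , column r)
    φ-onto : StrictlySurjective _≡_ φ
    φ-onto b with orth a b
    ... | (r , k) , Mrk≡a , Nrk≡b = r , subst (λ k → N (r , k) ≡ b) (on-column Mrk≡a) Nrk≡b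
    same-row : i ≡ i'
    same-row = onto⇒injective φ φ-onto (begin
      φ i          ≡⟨ cong (λ k → N (i , k)) (sym j≡column) ⟩
      N (i , j)    ≡⟨ eN ⟩
      N (i' , j')  ≡⟨ cong (λ k → N (i' , k)) j'≡column ⟩
      φ i'         ∎)

-- The net of L₁, …, L_w

module Net {w s : ℕ} (L : Fin w → Square s) where

  Collinear : Cell s → Cell s → Set
  Collinear P Q = Σ (Line w s) (λ ℓ → OnLine L ℓ P × OnLine L ℓ Q)

  two-lines-meet-once : MOLS L → ∀ {ℓ m x y} → ℓ ≢ m →
    OnLine L ℓ x → OnLine L m x → OnLine L ℓ y → OnLine L m y → x ≡ y
  two-lines-meet-once _ {rowLine _} {rowLine _} ℓ≢m p q _ _ = ⊥-elim (ℓ≢m (cong rowLine (trans (sym p) q)))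
  two-lines-meet-once _ {rowLine _} {colLine _} _ p q p' q' = cong₂ _,_ (trans p (sym p')) (trans q (sym q'))
  two-lines-meet-once (latin , _) {rowLine _} {symLine k _} _ p q p' q' =
    latin-row (latin k) (trans p (sym p')) (trans q (sym q'))
  two-lines-meet-once _ {colLine _} {rowLine _} _ p q p' q' = cong₂ _,_ (trans q (sym q')) (trans p (sym p'))
  two-lines-meet-once _ {colLine _} {colLine _} ℓ≢m p q _ _ = ⊥-elim (ℓ≢m (cong colLine (trans (sym p) q)))
  two-lines-meet-once (latin , _) {colLine _} {symLine k _} _ p q p' q' =
    latin-col (latin k) (trans p (sym p')) (trans q (sym q'))
  two-lines-meet-once (latin , _) {symLine k _} {rowLine _} _ p q p' q' =
    latin-row (latin k) (trans q (sym q')) (trans p (sym p'))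
  two-lines-meet-once (latin , _) {symLine k _} {colLine _} _ p q p' q' =
    latin-col (latin k) (trans q (sym q')) (trans p (sym p'))
  two-lines-meet-once (latin , orth) {symLine k _} {symLine l _} ℓ≢m p q p' q' with k ≟ l
  ... | yes′ refl = ⊥-elim (ℓ≢m (cong (symLine k) (trans (sym p) q)))
  ... | no′ k≢l = orthogonal-injective (latin k) (orth k l k≢l) (trans p (sym p')) (trans q (sym q'))

  pencil : Cell s → Fin (2 + w) → Line w s
  pencil a zero = rowLine (row a)
  pencil a (suc zero) = colLine (col a)
  pencil a (suc (suc k)) = symLine k (L k a)

  pencil-through : ∀ a i → OnLine L (pencil a i) a
  pencil-through a zero = refl
  pencil-through a (suc zero) = refl
  pencil-through a (suc (suc k)) = refl

  pencil-injective : ∀ a → Injective _≡_ _≡_ (pencil a)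
  pencil-injective a {zero} {zero} _ = refl
  pencil-injective a {suc zero} {suc zero} _ = refl
  pencil-injective a {suc (suc k)} {suc (suc .k)} refl = refl
  pencil-injective a {zero} {suc zero} ()
  pencil-injective a {zero} {suc (suc _)} ()
  pencil-injective a {suc zero} {zero} ()
  pencil-injective a {suc zero} {suc (suc _)} ()
  pencil-injective a {suc (suc _)} {zero} ()
  pencil-injective a {suc (suc _)} {suc zero} ()

  pencil-complete : ∀ {a} ℓ → OnLine L ℓ a → Σ (Fin (2 + w)) (λ i → pencil a i ≡ ℓ)
  pencil-complete (rowLine _) p = zero , cong rowLine p
  pencil-complete (colLine _) p = suc zero , cong colLine p
  pencil-complete (symLine k _) p = suc (suc k) , cong (symLine k) p

  on-pencil⇔collinear : ∀ {a x} → Σ (Fin (2 + w)) (λ i → OnLine L (pencil a i) x) ⇔ Collinear a x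
  on-pencil⇔collinear {a} {x} = mk⇔
    (λ (i , p) → pencil a i , pencil-through a i , p)
    (λ (ℓ , pa , px) → let (i , pencil≡ℓ) = pencil-complete ℓ pa in
      i , subst (λ m → OnLine L m x) (sym pencil≡ℓ) px)

  -- If every line meets X exactly once and a ∉ X, then exactly w + 2 points
  -- of X are collinear with a, one on each line of the pencil.
  collinear-count : MOLS L → ∀ {a X} → a ∉ X → (∀ ℓ → CountIs (OnLine L ℓ) X 1) →
    CountIs (Collinear a) X (2 + w)
  collinear-count mols {a} {X} a∉X once =
    count-cong (λ _ → on-pencil⇔collinear)
      (count-Σ (2 + w) (λ i → OnLine L (pencil a i)) disjoint (λ i → once (pencil a i)))
    where
    disjoint : ∀ {x} → x ∈ X → ∀ {i j} → OnLine L (pencil a i) x → OnLine L (pencil a j) x → i ≡ j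
    disjoint x∈ {i} {j} p q with i ≟ j
    ... | yes′ i≡j = i≡j
    ... | no′ i≢j = ⊥-elim (a∉X (subst (_∈ X)
            (two-lines-meet-once mols (i≢j ∘ pencil-injective a) p q (pencil-through a i) (pencil-through a j)) x∈))

  non-collinear-count : MOLS L → ∀ {a X} → a ∉ X → length X ≡ s → (∀ ℓ → CountIs (OnLine L ℓ) X 1) →
    CountIs (λ x → ¬ Collinear a x) X (s ∸ (2 + w))
  non-collinear-count mols {X = X} a∉X len once =
    subst (CountIs _ X) (cong (_∸ (2 + w)) len) (count-complement (collinear-count mols a∉X once))

  meets-once⇒non-collinear : ∀ {T x y} → (∀ ℓ → CountIs (OnLine L ℓ) T 1) →
    x ∈ T → y ∈ T → x ≢ y → ¬ Collinear x y
  meets-once⇒non-collinear once x∈ y∈ x≢y (ℓ , px , py) = x≢y (count-one⇒unique (once ℓ) x∈ y∈ px py)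

  non-collinear-meets-once : ∀ {T} → AllPairs (λ x y → ¬ Collinear x y) T → length T ≡ s →
    ∀ ℓ → CountIs (OnLine L ℓ) T 1
  non-collinear-meets-once apart len (rowLine r) =
    coordinate-hits-once row (AllPairs.map (λ {x} nc e → nc (rowLine (row x) , refl , sym e)) apart) len r
  non-collinear-meets-once apart len (colLine j) =
    coordinate-hits-once col (AllPairs.map (λ {x} nc e → nc (colLine (col x) , refl , sym e)) apart) len j
  non-collinear-meets-once apart len (symLine k b) =
    coordinate-hits-once (L k) (AllPairs.map (λ {x} nc e → nc (symLine k (L k x) , refl , sym e)) apart) len b

  common-transversal-meets-once : ∀ {T} → CommonTransversal L T → ∀ ℓ → CountIs (OnLine L ℓ) T 1
  common-transversal-meets-once (_ , _ , rows , _ , _) (rowLine r) = rows r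
  common-transversal-meets-once (_ , _ , _ , cols , _) (colLine j) = cols j
  common-transversal-meets-once (_ , len , _ , _ , symbols) (symLine k b) =
    coordinate-hits-once (L k) (symbols k) len b

  net-transversal-meets-once : ∀ {T} → NetTransversal L T → ∀ ℓ → CountIs (OnLine L ℓ) T 1
  net-transversal-meets-once (distinct , len , unjoined) =
    non-collinear-meets-once
      (AllPairs.zipWith (λ (x≢y , ¬joined) collinear → ¬joined (x≢y , collinear)) (distinct , unjoined)) len

  non-collinear⇔first-assoc : ∀ {a x} → a ≢ x → (¬ Collinear a x) ⇔ FirstAssoc L a x
  non-collinear⇔first-assoc {a} a≢x = mk⇔
    (λ nc → a≢x , (λ e → nc (rowLine (row a) , refl , sym e)) , (λ e → nc (colLine (col a) , refl , sym e))
               , (λ k e → nc (symLine k (L k a) , refl , sym e)))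
    (λ { (_ , rows , cols , symbols) → λ
      { (rowLine _ , p , q) → rows (trans p (sym q))
      ; (colLine _ , p , q) → cols (trans p (sym q))
      ; (symLine k _ , p , q) → symbols k (trans p (sym q)) } })

  non-collinear⇔unjoined : ∀ {a x} → a ≢ x → (¬ Collinear a x) ⇔ (¬ Joined L a x)
  non-collinear⇔unjoined a≢x = mk⇔ (λ nc (_ , collinear) → nc collinear) (λ ¬joined collinear → ¬joined (a≢x , collinear))

  -- Part (1) for any n with s - (w + 2) = n + 1: count the first associates
  -- of a in t ∷ Aj, then discard t, which is one of them.
  first-associates-count : MOLS L → ∀ {n} → s ∸ (2 + w) ≡ suc n →
    (t : Cell s) → (Ai Aj : List (Cell s)) → (∀ c → c ∈ Ai → c ∉ Aj) →
    CommonTransversal L (t ∷ Ai) → CommonTransversal L (t ∷ Aj) →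
    ∀ a → a ∈ Ai → CountIs (FirstAssoc L a) Aj n
  first-associates-count mols count≡ t Ai Aj disjoint Ti@(uniqueI , _) Tj@(_ , lenJ , _) a a∈Ai =
    count-tail (subst (CountIs _ _) count≡ in-t∷Aj)
      (Equivalence.to (non-collinear⇔first-assoc a≢t)
        (meets-once⇒non-collinear (common-transversal-meets-once Ti) (there a∈Ai) (here refl) a≢t))
    where
    a≢t : a ≢ t
    a≢t refl = Unique[x∷xs]⇒x∉xs uniqueI a∈Ai
    a∉t∷Aj : a ∉ t ∷ Aj
    a∉t∷Aj (here a≡t) = a≢t a≡t
    a∉t∷Aj (there a∈Aj) = disjoint a a∈Ai a∈Aj
    in-t∷Aj : CountIs (FirstAssoc L a) (t ∷ Aj) (s ∸ (2 + w))
    in-t∷Aj = count-cong (λ x∈ → non-collinear⇔first-assoc (λ a≡x → a∉t∷Aj (subst (_∈ _) (sym a≡x) x∈)))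
      (non-collinear-count mols a∉t∷Aj lenJ (common-transversal-meets-once Tj))

  -- Part (2) for any n with s - (w + 2) = n + 1: count the points of αj not
  -- joined to Q, then discard P, which is one of them.
  unjoined-count : MOLS L → ∀ {n} → s ∸ (2 + w) ≡ suc n →
    (αi αj : List (Cell s)) → (P : Cell s) →
    NetTransversal L αi → NetTransversal L αj →
    (∀ c → (c ∈ αi × c ∈ αj) ⇔ (c ≡ P)) →
    ∀ Q → Q ∈ αi → Q ≢ P → CountIs (λ R → R ≢ P × ¬ Joined L Q R) αj n
  unjoined-count mols count≡ αi αj P Ni Nj@(uniqueJ , lenJ , _) meet Q Q∈αi Q≢P =
    count-cong (λ R∈ → mk⇔ (map₂ (Equivalence.to (unjoined R∈))) (map₂ (Equivalence.from (unjoined R∈))))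
      (count-without uniqueJ (proj₂ P∈both) P-unjoined
        (subst (CountIs _ αj) count≡ (non-collinear-count mols Q∉αj lenJ (net-transversal-meets-once Nj))))
    where
    P∈both : P ∈ αi × P ∈ αj
    P∈both = Equivalence.from (meet P) refl
    Q∉αj : Q ∉ αj
    Q∉αj Q∈αj = Q≢P (Equivalence.to (meet Q) (Q∈αi , Q∈αj))
    P-unjoined : ¬ Collinear Q P
    P-unjoined = meets-once⇒non-collinear (net-transversal-meets-once Ni) Q∈αi (proj₁ P∈both) Q≢P
    unjoined : ∀ {R} → R ∈ αj → (¬ Collinear Q R) ⇔ (¬ Joined L Q R)
    unjoined R∈ = non-collinear⇔unjoined (λ Q≡R → Q∉αj (subst (_∈ αj) (sym Q≡R) R∈))

∸-shift : ∀ w m → 2 + w ≤ m → m ∸ suc w ≡ suc ((m ∸ w) ∸ 2)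
∸-shift zero (suc (suc m)) _ = refl
∸-shift zero (suc zero) (s≤s ())
∸-shift (suc w) (suc m) (s≤s le) = ∸-shift w m le

count-arith : ∀ w s → 3 + w ≤ s → s ∸ (2 + w) ≡ suc ((s ∸ 1 ∸ w) ∸ 2)
count-arith w (suc m) (s≤s le) = ∸-shift w m le

theorem3p9 : (w s : ℕ) → 1 ≤ w → w + 4 ≤ s → (L : Fin w → Square s) → MOLS L →
    ((t : Cell s) → (Ai Aj : List (Cell s)) → (∀ c → c ∈ Ai → c ∉ Aj) →
    CommonTransversal L (t ∷ Ai) → CommonTransversal L (t ∷ Aj) →
    ∀ a → a ∈ Ai → CountIs (FirstAssoc L a) Aj ((s ∸ 1 ∸ w) ∸ 2))
    × ((αi αj : List (Cell s)) → (P : Cell s) →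
    NetTransversal L αi → NetTransversal L αj →
    (∀ c → (c ∈ αi × c ∈ αj) ⇔ (c ≡ P)) →
    ∀ Q → Q ∈ αi → Q ≢ P →
    CountIs (λ R → R ≢ P × ¬ Joined L Q R) αj ((s ∸ 1 ∸ w) ∸ 2))
theorem3p9 w s _ w+4≤s L mols = first-associates-count mols count≡ , unjoined-count mols count≡
  where
  open Net L
  3+w≤s : 3 + w ≤ s
  3+w≤s = ≤-trans (subst (_≤ w + 4) (+-comm w 3) (+-monoʳ-≤ w (n≤1+n 3))) w+4≤s
  count≡ : s ∸ (2 + w) ≡ suc ((s ∸ 1 ∸ w) ∸ 2)
  count≡ = count-arith w s 3+w≤s
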